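{- Let $\mathcal{M}$ be a normal $S3^\forall_\equiv$-model and $\le_\mathcal{M}$ its preorder. The following are equivalent: (i) $\mathcal{M}$ is a Boolean algebra and satisfies the Collapse Axiom; (ii) $\mathcal{M}$ is a Boolean algebra with $\mathit{NEC}=\{f_\top\}$; (iii) $\le_\mathcal{M}$ is a partial order; (iv) strict equivalence coincides with propositional identity, i.e., $\mathcal{M}\vDash\forall x\forall y((x\equiv y)\leftrightarrow(\square(x\rightarrow y)\wedge\square(y\rightarrow x)))$.
   Context: Language: $Fm(C)$ is the set of formulas built from propositional variables $V$, a set $C$ of propositional constants containing $\top,\bot$, connectives $\neg,\rightarrow,\vee,\wedge$, identity connective $\equiv$, necessity $\square$ and universal propositional quantifier $\forall$. The Collapse Axiom is the scheme $(\square\varphi\wedge\square\psi)\rightarrow(\varphi\equiv\psi)$ ("there is only one necessary proposition"). Semantics: a propositional domain is $\mathcal{M}=(M,\mathit{TRUE},\mathit{NEC},f_\bot,f_\top,f_\square,f_\neg,f_\vee,f_\wedge,f_\rightarrow,f_\equiv,f_\forall,\varGamma)$ with $\mathit{TRUE},\mathit{NEC}\subseteq M$, operations of obvious arities, $f_\forall\colon M^M\to M$, $\varGamma\colon C\to M$ with $\varGamma(\bot)=f_\bot,\varGamma(\top)=f_\top$; assignments $\gamma\colon V\to M$ extend homomorphically with $\gamma(c)=\varGamma(c)$ and $\gamma(\forall x\varphi)=f_\forall(m\mapsto\gamma_x^m(\varphi))$. $t\colon M\to M$ is $(\varphi,x,\gamma)$-definable if $t(m)=\gamma_x^m(\varphi)$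 for all $m$ (definable if so for some $\varphi,x,\gamma$). With $a\le_\mathcal{M}b:\Leftrightarrow f_\rightarrow(a,b)\in\mathit{NEC}$ and $\approx_\mathcal{M}$ its symmetric part, $\mathcal{M}$ is an $S3^\forall_\equiv$-model if: (1) when $\mathit{NEC}\neq\varnothing$, $\le_\mathcal{M}$ is a preorder making $(M,f_\bot,f_\top,f_\neg,f_\vee,f_\wedge,f_\rightarrow,\le_\mathcal{M})$ a Boolean prealgebra (i.e. $\approx_\mathcal{M}$ is a congruence and the quotient is a Boolean algebra with order induced by $\le_\mathcal{M}$ and induced operations as bottom, top, complement, join, meet, implication); (2) $f_\bot\notin\mathit{TRUE}$, $f_\top\in\mathit{TRUE}$, classical truth conditions for $f_\rightarrow,f_\neg,f_\wedge,f_\vee$, $f_\square(a)\in\mathit{TRUE}\Leftrightarrow a\in\mathit{NEC}$, $f_\equiv(a,b)\in\mathit{TRUE}\Leftrightarrow a=b$, $f_\forall(t)\in\mathit{TRUE}$ for definable $t$ with image in $\mathit{TRUE}$; (3) when $\mathit{NEC}\neq\varnothing$, $\mathit{NEC}\subseteq\mathit{TRUE}$ is upward closed under $\le_\mathcal{M}$ and closed under $f_\wedge$; (4) when $\mathit{NEC}\neq\varnothing$: $f_\top\le_\mathcal{M}f_\equiv(a,a)$; $f_\equiv(a,b)\le_\mathcal{M}f_\rightarrow(a,b)$; $f_\equiv(a,b)\le_\mathcal{M}f_\equiv(t(a),t(b))$ for definable $t$; $f_\square(a)\le_\mathcal{M}a$; $f_\square(f_\rightarrow(a,b))\le_\mathcal{M}f_\rightarrow(f_\square(a),f_\square(b))$;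 $f_\square(f_\rightarrow(a,b))\le_\mathcal{M}f_\square(f_\rightarrow(f_\square(a),f_\square(b)))$; $f_\forall(t)\le_\mathcal{M}f_\equiv(f_\forall(t_1),f_\forall(t_2))$ and $f_\forall(t)\le_\mathcal{M}f_\rightarrow(f_\forall(t_1),f_\forall(t_2))$ for $t_1,t_2$ $(\varphi,x,\gamma)$-, $(\psi,x,\gamma)$-definable and $t$ the pointwise $f_\equiv$, resp. $f_\rightarrow$, of $t_1,t_2$; $f_\forall(t)\le_\mathcal{M}t(a)$ for definable $t$; $f_\forall(t)\le_\mathcal{M}f_\rightarrow(b,f_\forall(t'))$ for $t'$ $(\psi,x,\gamma)$-definable, $b$ the denotation of a sentence and $t(a)=f_\rightarrow(b,t'(a))$; $f_\square(f_\forall(t))\approx_\mathcal{M}f_\forall(a\mapsto f_\square(t(a)))$ for definable $t$; $f_\forall(t)\in\mathit{NEC}$ for definable $t$ with image in $\mathit{NEC}$. It is normal if $\mathit{NEC}\neq\varnothing$. $(\mathcal{M},\gamma)\vDash\varphi:\Leftrightarrow\gamma(\varphi)\in\mathit{TRUE}$; $\mathcal{M}\vDash\varphi$ means true under all assignments; $\mathcal{M}$ satisfies the Collapse Axiom if all its instances are true in $\mathcal{M}$ under all assignments. -}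

module Defs where

open import Data.Nat using (ℕ; _≟_)
open import Data.Product using (Σ; _×_; _,_; ∃)
open import Data.Sum using (_⊎_)
open import Data.Empty using (⊥)
open import Relation.Nullary using (¬_; yes; no)
open import Relation.Binary.PropositionalEquality using (_≡_)
open import Relation.Binary.Structures using (IsPreorder)
open import Algebra.Lattice.Structures using (IsBooleanAlgebra)
open import Function.Bundles using (_⇔_)

-- Syntax.  Variables V = ℕ.  The set C of propositional constants is
-- represented as ⊤ and ⊥ (constructors 'top', 'bot') plus an arbitrary
-- type C of further constants.

infixr 5 _⇒_
infixr 6 _∨'_
infixr 7 _∧'_
infix 8 _≡'_

data Fm (C : Set) : Set where
  var   : ℕ → Fm C
  con   : C → Fm C
  top   : Fm C
  bot   : Fm C
  ¬'_   : Fm C → Fm C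
  _⇒_   : Fm C → Fm C → Fm C
  _∨'_  : Fm C → Fm C → Fm C
  _∧'_  : Fm C → Fm C → Fm C
  _≡'_  : Fm C → Fm C → Fm C
  □_    : Fm C → Fm C
  ∀'    : ℕ → Fm C → Fm C

_⇔'_ : ∀ {C} → Fm C → Fm C → Fm C
φ ⇔' ψ = (φ ⇒ ψ) ∧' (ψ ⇒ φ)

data FreeIn {C : Set} (x : ℕ) : Fm C → Set where
  fr-var : FreeIn x (var x)
  fr-¬   : ∀ {φ} → FreeIn x φ → FreeIn x (¬' φ)
  fr-⇒l  : ∀ {φ ψ} → FreeIn x φ → FreeIn x (φ ⇒ ψ)
  fr-⇒r  : ∀ {φ ψ} → FreeIn x ψ → FreeIn x (φ ⇒ ψ)
  fr-∨l  : ∀ {φ ψ} → FreeIn x φ → FreeIn x (φ ∨' ψ)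
  fr-∨r  : ∀ {φ ψ} → FreeIn x ψ → FreeIn x (φ ∨' ψ)
  fr-∧l  : ∀ {φ ψ} → FreeIn x φ → FreeIn x (φ ∧' ψ)
  fr-∧r  : ∀ {φ ψ} → FreeIn x ψ → FreeIn x (φ ∧' ψ)
  fr-≡l  : ∀ {φ ψ} → FreeIn x φ → FreeIn x (φ ≡' ψ)
  fr-≡r  : ∀ {φ ψ} → FreeIn x ψ → FreeIn x (φ ≡' ψ)
  fr-□   : ∀ {φ} → FreeIn x φ → FreeIn x (□ φ)
  fr-∀   : ∀ {y φ} → ¬ (x ≡ y) → FreeIn x φ → FreeIn x (∀' y φ)

Sentence : ∀ {C} → Fm C → Set
Sentence φ = ∀ x → ¬ FreeIn x φ

record PropDomain (C : Set) : Set₁ where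
  field
    M    : Set
    TRUE : M → Set
    NEC  : M → Set
    f⊥ f⊤ : M
    f□ f¬ : M → M
    f∨ f∧ f→ f≡ : M → M → M
    f∀   : (M → M) → M
    Γ    : C → M

  Assignment : Set
  Assignment = ℕ → M

  _[_↦_] : Assignment → ℕ → M → Assignment
  (γ [ x ↦ m ]) y with y ≟ x
  ... | yes _ = m
  ... | no  _ = γ y

  ⟦_⟧ : Fm C → Assignment → M
  ⟦ var x ⟧ γ = γ x
  ⟦ con c ⟧ γ = Γ c
  ⟦ top ⟧ γ = f⊤
  ⟦ bot ⟧ γ = f⊥
  ⟦ ¬' φ ⟧ γ = f¬ (⟦ φ ⟧ γ)
  ⟦ φ ⇒ ψ ⟧ γ = f→ (⟦ φ ⟧ γ) (⟦ ψ ⟧ γ)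
  ⟦ φ ∨' ψ ⟧ γ = f∨ (⟦ φ ⟧ γ) (⟦ ψ ⟧ γ)
  ⟦ φ ∧' ψ ⟧ γ = f∧ (⟦ φ ⟧ γ) (⟦ ψ ⟧ γ)
  ⟦ φ ≡' ψ ⟧ γ = f≡ (⟦ φ ⟧ γ) (⟦ ψ ⟧ γ)
  ⟦ □ φ ⟧ γ = f□ (⟦ φ ⟧ γ)
  ⟦ ∀' x φ ⟧ γ = f∀ (λ m → ⟦ φ ⟧ (γ [ x ↦ m ]))

  DefBy : (M → M) → Fm C → ℕ → Assignment → Set
  DefBy t φ x γ = ∀ m → t m ≡ ⟦ φ ⟧ (γ [ x ↦ m ])

  Definable : (M → M) → Set
  Definable t = Σ (Fm C) λ φ → Σ ℕ λ x → Σ Assignment λ γ → DefBy t φ x γ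

  SentDenot : M → Set
  SentDenot b = Σ (Fm C) λ φ → Sentence φ × Σ Assignment λ γ → b ≡ ⟦ φ ⟧ γ

  _≤M_ : M → M → Set
  a ≤M b = NEC (f→ a b)

  _≈M_ : M → M → Set
  a ≈M b = (a ≤M b) × (b ≤M a)

  NonemptyNEC : Set
  NonemptyNEC = Σ M NEC

  _⊨[_] : Fm C → Assignment → Set
  φ ⊨[ γ ] = TRUE (⟦ φ ⟧ γ)

  ⊨_ : Fm C → Set
  ⊨ φ = ∀ γ → φ ⊨[ γ ]

  record IsBooleanPrealgebra : Set where
    field
      preorder    : IsPreorder _≡_ _≤M_
      boolean     : IsBooleanAlgebra _≈M_ f∨ f∧ f¬ f⊤ f⊥
      →-cong      : ∀ {a a' b b'} → a ≈M a' → b ≈M b' → f→ a b ≈M f→ a' b'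
      order       : ∀ a b → (a ≤M b) ⇔ (f∧ a b ≈M a)
      implication : ∀ a b → f→ a b ≈M f∨ (f¬ a) b

  record IsS3Model : Set where
    field
      prealg : NonemptyNEC → IsBooleanPrealgebra
      ⊥-false : ¬ TRUE f⊥
      ⊤-true  : TRUE f⊤
      →-true  : ∀ a b → TRUE (f→ a b) ⇔ (TRUE a → TRUE b)
      ¬-true  : ∀ a → TRUE (f¬ a) ⇔ (¬ TRUE a)
      ∧-true  : ∀ a b → TRUE (f∧ a b) ⇔ (TRUE a × TRUE b)
      ∨-true  : ∀ a b → TRUE (f∨ a b) ⇔ (TRUE a ⊎ TRUE b)
      □-true  : ∀ a → TRUE (f□ a) ⇔ NEC a
      ≡-true  : ∀ a b → TRUE (f≡ a b) ⇔ (a ≡ b)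
      ∀-true  : ∀ t → Definable t → (∀ m → TRUE (t m)) → TRUE (f∀ t)
      NEC⊆TRUE : NonemptyNEC → ∀ a → NEC a → TRUE a
      NEC-up   : NonemptyNEC → ∀ a b → NEC a → a ≤M b → NEC b
      NEC-∧    : NonemptyNEC → ∀ a b → NEC a → NEC b → NEC (f∧ a b)
      ax-≡refl : NonemptyNEC → ∀ a → f⊤ ≤M f≡ a a
      ax-≡→    : NonemptyNEC → ∀ a b → f≡ a b ≤M f→ a b
      ax-≡sub  : NonemptyNEC → ∀ t → Definable t → ∀ a b →
                 f≡ a b ≤M f≡ (t a) (t b)
      ax-T     : NonemptyNEC → ∀ a → f□ a ≤M a
      ax-K     : NonemptyNEC → ∀ a b → f□ (f→ a b) ≤M f→ (f□ a) (f□ b)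
      ax-S3    : NonemptyNEC → ∀ a b →
                 f□ (f→ a b) ≤M f□ (f→ (f□ a) (f□ b))
      ax-∀≡    : NonemptyNEC → ∀ t₁ t₂ φ ψ x γ → DefBy t₁ φ x γ → DefBy t₂ ψ x γ →
                 f∀ (λ a → f≡ (t₁ a) (t₂ a)) ≤M f≡ (f∀ t₁) (f∀ t₂)
      ax-∀→    : NonemptyNEC → ∀ t₁ t₂ φ ψ x γ → DefBy t₁ φ x γ → DefBy t₂ ψ x γ →
                 f∀ (λ a → f→ (t₁ a) (t₂ a)) ≤M f→ (f∀ t₁) (f∀ t₂)
      ax-∀inst : NonemptyNEC → ∀ t → Definable t → ∀ a → f∀ t ≤M t a
      ax-∀vac  : NonemptyNEC → ∀ t t' ψ x γ b → DefBy t' ψ x γ → SentDenot b →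
                 (∀ a → t a ≡ f→ b (t' a)) → f∀ t ≤M f→ b (f∀ t')
      ax-BF    : NonemptyNEC → ∀ t → Definable t →
                 f□ (f∀ t) ≈M f∀ (λ a → f□ (t a))
      ax-∀nec  : NonemptyNEC → ∀ t → Definable t → (∀ a → NEC (t a)) → NEC (f∀ t)

  IsNormalS3Model : Set
  IsNormalS3Model = IsS3Model × NonemptyNEC

  SatisfiesCollapse : Set
  SatisfiesCollapse = ∀ φ ψ → ⊨ ((□ φ ∧' □ ψ) ⇒ (φ ≡' ψ))

  IsBooleanAlgebraM : Set
  IsBooleanAlgebraM =
    IsBooleanAlgebra _≡_ f∨ f∧ f¬ f⊤ f⊥ × (∀ a b → f→ a b ≡ f∨ (f¬ a) b)

  IsPartialOrderM : Set
  IsPartialOrderM = IsPreorder _≡_ _≤M_ × (∀ a b → a ≤M b → b ≤M a → a ≡ b)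

  strictEquivFormula : Fm C
  strictEquivFormula =
    ∀' 0 (∀' 1 ((var 0 ≡' var 1) ⇔'
                 (□ (var 0 ⇒ var 1) ∧' □ (var 1 ⇒ var 0))))

-- In a normal S3-model the quotient by strict equivalence ≈M is a Boolean
-- algebra whose top class is exactly NEC.  Each of the four conditions says
-- that this quotient is trivial, i.e. that ≈M is already identity: the
-- Collapse Axiom identifies every necessary proposition with f⊤, which by
-- the Boolean-algebra laws forces antisymmetry of ≤M; antisymmetry turns
-- the Boolean prealgebra into a Boolean algebra on the nose and makes
-- strict equivalence and identity coincide, which is what the formula in
-- (iv) expresses.
module Submission where

open import Defs
open import Data.Product using (_×_; _,_; proj₁; proj₂)
open import Relation.Binary.PropositionalEquality
  using (_≡_; refl; cong; cong₂; subst)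
import Relation.Binary.PropositionalEquality as ≡
open import Relation.Binary.Core using (Rel)
open import Relation.Binary.Bundles using (Poset)
open import Relation.Binary.Definitions using (Antisymmetric)
open import Relation.Binary.Structures using (IsPreorder)
open import Function.Bundles using (_⇔_; mk⇔; module Equivalence)
open import Algebra.Core using (Op₁; Op₂)
open import Algebra.Lattice.Structures using (IsBooleanAlgebra)
open import Algebra.Lattice.Bundles using (BooleanAlgebra)
import Algebra.Lattice.Properties.BooleanAlgebra as BooleanAlgebraProperties
open Equivalence using (to; from)
import Function.Properties.Equivalence as ⇔

isBooleanAlgebra-≡ : ∀ {a ℓ} {A : Set a} {_≈_ : Rel A ℓ} {∨ ∧ : Op₂ A} {¬ : Op₁ A} {⊤ ⊥ : A} →
  (∀ {x y} → x ≈ y → x ≡ y) →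
  IsBooleanAlgebra _≈_ ∨ ∧ ¬ ⊤ ⊥ → IsBooleanAlgebra _≡_ ∨ ∧ ¬ ⊤ ⊥
isBooleanAlgebra-≡ {∨ = ∨} {∧} {¬} ≈⇒≡ isBA = record
  { isDistributiveLattice = record
    { isLattice = record
      { isEquivalence = ≡.isEquivalence
      ; ∨-comm        = λ x y → ≈⇒≡ (∨-comm x y)
      ; ∨-assoc       = λ x y z → ≈⇒≡ (∨-assoc x y z)
      ; ∨-cong        = cong₂ ∨
      ; ∧-comm        = λ x y → ≈⇒≡ (∧-comm x y)
      ; ∧-assoc       = λ x y z → ≈⇒≡ (∧-assoc x y z)
      ; ∧-cong        = cong₂ ∧
      ; absorptive    = (λ x y → ≈⇒≡ (∨-absorbs-∧ x y)) , (λ x y → ≈⇒≡ (∧-absorbs-∨ x y))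
      }
    ; ∨-distrib-∧ = (λ x y z → ≈⇒≡ (∨-distribˡ-∧ x y z)) , (λ x y z → ≈⇒≡ (∨-distribʳ-∧ x y z))
    ; ∧-distrib-∨ = (λ x y z → ≈⇒≡ (∧-distribˡ-∨ x y z)) , (λ x y z → ≈⇒≡ (∧-distribʳ-∨ x y z))
    }
  ; ∨-complement = (λ x → ≈⇒≡ (∨-complementˡ x)) , (λ x → ≈⇒≡ (∨-complementʳ x))
  ; ∧-complement = (λ x → ≈⇒≡ (∧-complementˡ x)) , (λ x → ≈⇒≡ (∧-complementʳ x))
  ; ¬-cong       = cong ¬
  }
  where open IsBooleanAlgebra isBA

module _ {c ℓ} (B : BooleanAlgebra c ℓ) where
  open BooleanAlgebra B
  open BooleanAlgebraProperties B using (poset; ∧-identityʳ; ∨-identityˡ)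
  open Poset poset using (_≤_; antisym)
  open import Relation.Binary.Reasoning.Setoid setoid

  ¬x∨y≈⊤⇒x≤y : ∀ x y → ¬ x ∨ y ≈ ⊤ → x ≤ y
  ¬x∨y≈⊤⇒x≤y x y ¬x∨y≈⊤ = begin
    x                    ≈⟨ ∧-identityʳ x ⟨
    x ∧ ⊤                ≈⟨ ∧-congˡ ¬x∨y≈⊤ ⟨
    x ∧ (¬ x ∨ y)        ≈⟨ ∧-distribˡ-∨ x (¬ x) y ⟩
    (x ∧ ¬ x) ∨ (x ∧ y)  ≈⟨ ∨-congʳ (∧-complementʳ x) ⟩
    ⊥ ∨ (x ∧ y)          ≈⟨ ∨-identityˡ (x ∧ y) ⟩
    x ∧ y                ∎

  ¬∨-antisym : ∀ x y → ¬ x ∨ y ≈ ⊤ → ¬ y ∨ x ≈ ⊤ → x ≈ y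
  ¬∨-antisym x y x⇒y y⇒x = antisym (¬x∨y≈⊤⇒x≤y x y x⇒y) (¬x∨y≈⊤⇒x≤y y x y⇒x)

module NormalS3Model {C : Set} (𝓜 : PropDomain C)
                     (S3 : PropDomain.IsS3Model 𝓜) (normal : PropDomain.NonemptyNEC 𝓜) where
  open PropDomain 𝓜
  open IsS3Model S3
  open IsBooleanPrealgebra (prealg normal)

  quotientAlgebra : BooleanAlgebra _ _
  quotientAlgebra = record { isBooleanAlgebra = boolean }

  module Q = BooleanAlgebra quotientAlgebra
  open BooleanAlgebraProperties quotientAlgebra using (¬⊤≈⊥; ∨-identityˡ; ∨-zeroʳ)

  ≡⇒≈M : ∀ {a b} → a ≡ b → a ≈M b
  ≡⇒≈M refl = Q.refl

  -- f⊤ → f⊤ is necessary by reflexivity of ≤M and lies below f⊤.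
  NEC-f⊤ : NEC f⊤
  NEC-f⊤ = NEC-up normal (f→ f⊤ f⊤) f⊤ (IsPreorder.refl preorder)
             (proj₁ (Q.trans (implication f⊤ f⊤) (Q.∨-complementˡ f⊤)))

  NEC⇒≈Mf⊤ : ∀ {a} → NEC a → a ≈M f⊤
  NEC⇒≈Mf⊤ {a} NECa =
      NEC-up normal f⊤ _ NEC-f⊤ (proj₂ (Q.trans (implication a f⊤) (∨-zeroʳ (f¬ a))))
    , NEC-up normal a _ NECa (proj₂ f⊤⇒a≈Ma)
    where
    f⊤⇒a≈Ma : f→ f⊤ a ≈M a
    f⊤⇒a≈Ma = Q.trans (implication f⊤ a) (Q.trans (Q.∨-congʳ ¬⊤≈⊥) (∨-identityˡ a))

  □∧□-true : ∀ a b → TRUE (f∧ (f□ a) (f□ b)) ⇔ (NEC a × NEC b)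
  □∧□-true a b = mk⇔
    (λ t → let (□a , □b) = to (∧-true _ _) t in to (□-true a) □a , to (□-true b) □b)
    (λ (NECa , NECb) → from (∧-true _ _) (from (□-true a) NECa , from (□-true b) NECb))

  ⇔'-true : ∀ φ ψ γ → (φ ⇔' ψ) ⊨[ γ ] ⇔ (φ ⊨[ γ ] ⇔ ψ ⊨[ γ ])
  ⇔'-true φ ψ γ = mk⇔
    (λ t → let (φ⇒ψ , ψ⇒φ) = to (∧-true _ _) t in mk⇔ (to (→-true _ _) φ⇒ψ) (to (→-true _ _) ψ⇒φ))
    (λ φ⇔ψ → from (∧-true _ _) (from (→-true _ _) (to φ⇔ψ) , from (→-true _ _) (from φ⇔ψ)))

  -- Elimination needs normality: it goes through the axiom ∀x φ → φ[a/x] and NEC ⊆ TRUE.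
  ∀'-true : ∀ x φ γ → (∀' x φ) ⊨[ γ ] ⇔ (∀ m → φ ⊨[ γ [ x ↦ m ] ])
  ∀'-true x φ γ = mk⇔
    (λ t m → to (→-true _ _) (NEC⊆TRUE normal _ (ax-∀inst normal _ definable m)) t)
    (∀-true _ definable)
    where
    definable : Definable (λ m → ⟦ φ ⟧ (γ [ x ↦ m ]))
    definable = φ , x , γ , λ _ → refl

  IdentityIsStrictEquivalence : Set
  IdentityIsStrictEquivalence = ∀ a b → (a ≡ b) ⇔ (a ≈M b)

  ⊨strictEquivFormula⇔ : (⊨ strictEquivFormula) ⇔ IdentityIsStrictEquivalence
  ⊨strictEquivFormula⇔ = mk⇔
    (λ ⊨φ a b → let γ = λ _ → a in
      to (body-true (γ [ 0 ↦ a ] [ 1 ↦ b ]))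
         (to (∀'-true 1 body (γ [ 0 ↦ a ])) (to (∀'-true 0 (∀' 1 body) γ) (⊨φ γ) a) b))
    (λ ≡⇔≈M γ → from (∀'-true 0 (∀' 1 body) γ) λ a → from (∀'-true 1 body (γ [ 0 ↦ a ])) λ b →
      from (body-true (γ [ 0 ↦ a ] [ 1 ↦ b ])) (≡⇔≈M a b))
    where
    identity strictEquiv body : Fm C
    identity    = var 0 ≡' var 1
    strictEquiv = □ (var 0 ⇒ var 1) ∧' □ (var 1 ⇒ var 0)
    body        = identity ⇔' strictEquiv

    body-true : ∀ γ → body ⊨[ γ ] ⇔ ((γ 0 ≡ γ 1) ⇔ (γ 0 ≈M γ 1))
    body-true γ = ⇔.trans (⇔'-true identity strictEquiv γ) (mk⇔
      (λ e → ⇔.trans (⇔.sym (≡-true _ _)) (⇔.trans e (□∧□-true _ _)))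
      (λ e → ⇔.trans (≡-true _ _) (⇔.trans e (⇔.sym (□∧□-true _ _)))))

  collapse⇒NEC≡f⊤ : SatisfiesCollapse → ∀ a → NEC a → a ≡ f⊤
  collapse⇒NEC≡f⊤ collapse a NECa =
    to (≡-true a f⊤) (to (→-true _ _) (collapse (var 0) top (λ _ → a))
                        (from (□∧□-true a f⊤) (NECa , NEC-f⊤)))

  NEC⇔≡f⊤ : (∀ a → NEC a → a ≡ f⊤) → ∀ a → NEC a ⇔ (a ≡ f⊤)
  NEC⇔≡f⊤ NEC≡f⊤ a = mk⇔ (NEC≡f⊤ a) (λ a≡f⊤ → subst NEC (≡.sym a≡f⊤) NEC-f⊤)

  -- In the Boolean algebra M, a ≤M b says that a → b = ¬a ∨ b is necessary, hence equal to f⊤.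
  NEC≡f⊤⇒antisymmetric : IsBooleanAlgebraM → (∀ a → NEC a → a ≡ f⊤) → Antisymmetric _≡_ _≤M_
  NEC≡f⊤⇒antisymmetric (isBA , →≡¬∨) NEC≡f⊤ {a} {b} a≤b b≤a =
    ¬∨-antisym (record { isBooleanAlgebra = isBA }) a b
      (≡.trans (≡.sym (→≡¬∨ a b)) (NEC≡f⊤ _ a≤b))
      (≡.trans (≡.sym (→≡¬∨ b a)) (NEC≡f⊤ _ b≤a))

  module _ (antisym : Antisymmetric _≡_ _≤M_) where

    ≈M⇒≡ : ∀ {a b} → a ≈M b → a ≡ b
    ≈M⇒≡ (a≤b , b≤a) = antisym a≤b b≤a

    antisymmetric⇒booleanAlgebraM : IsBooleanAlgebraM
    antisymmetric⇒booleanAlgebraM = isBooleanAlgebra-≡ ≈M⇒≡ boolean , λ a b → ≈M⇒≡ (implication a b)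

    antisymmetric⇒NEC≡f⊤ : ∀ a → NEC a → a ≡ f⊤
    antisymmetric⇒NEC≡f⊤ _ NECa = ≈M⇒≡ (NEC⇒≈Mf⊤ NECa)

    antisymmetric⇒collapse : SatisfiesCollapse
    antisymmetric⇒collapse φ ψ γ = from (→-true _ _) λ □φ∧□ψ →
      let (NECφ , NECψ) = to (□∧□-true _ _) □φ∧□ψ in
      from (≡-true _ _) (≡.trans (antisymmetric⇒NEC≡f⊤ _ NECφ) (≡.sym (antisymmetric⇒NEC≡f⊤ _ NECψ)))

    antisymmetric⇒booleanCollapse : IsBooleanAlgebraM × SatisfiesCollapse
    antisymmetric⇒booleanCollapse = antisymmetric⇒booleanAlgebraM , antisymmetric⇒collapse

    antisymmetric⇒booleanNEC≡f⊤ : IsBooleanAlgebraM × (∀ a → NEC a ⇔ (a ≡ f⊤))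
    antisymmetric⇒booleanNEC≡f⊤ = antisymmetric⇒booleanAlgebraM , NEC⇔≡f⊤ antisymmetric⇒NEC≡f⊤

  booleanCollapse⇔antisymmetric : (IsBooleanAlgebraM × SatisfiesCollapse) ⇔ Antisymmetric _≡_ _≤M_
  booleanCollapse⇔antisymmetric = mk⇔
    (λ (isBA , collapse) → NEC≡f⊤⇒antisymmetric isBA (collapse⇒NEC≡f⊤ collapse))
    antisymmetric⇒booleanCollapse

  booleanNEC≡f⊤⇔antisymmetric :
    (IsBooleanAlgebraM × (∀ a → NEC a ⇔ (a ≡ f⊤))) ⇔ Antisymmetric _≡_ _≤M_
  booleanNEC≡f⊤⇔antisymmetric = mk⇔
    (λ (isBA , NEC⇔≡f⊤) → NEC≡f⊤⇒antisymmetric isBA (λ a → to (NEC⇔≡f⊤ a)))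
    antisymmetric⇒booleanNEC≡f⊤

  antisymmetric⇔partialOrder : Antisymmetric _≡_ _≤M_ ⇔ IsPartialOrderM
  antisymmetric⇔partialOrder = mk⇔ (λ antisym → preorder , λ a b → antisym {a} {b})
                                   (λ (_ , antisym) {a} {b} → antisym a b)

  antisymmetric⇔identityIsStrictEquivalence :
    Antisymmetric _≡_ _≤M_ ⇔ IdentityIsStrictEquivalence
  antisymmetric⇔identityIsStrictEquivalence = mk⇔
    (λ antisym a b → mk⇔ ≡⇒≈M (λ (a≤b , b≤a) → antisym a≤b b≤a))
    (λ ≡⇔≈M {a} {b} a≤b b≤a → from (≡⇔≈M a b) (a≤b , b≤a))

theorem30 : {C : Set} (𝓜 : PropDomain C) → let open PropDomain 𝓜 in
    IsNormalS3Model →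
      ((IsBooleanAlgebraM × SatisfiesCollapse)
          ⇔ (IsBooleanAlgebraM × (∀ a → NEC a ⇔ (a ≡ f⊤))))
      × ((IsBooleanAlgebraM × SatisfiesCollapse) ⇔ IsPartialOrderM)
      × ((IsBooleanAlgebraM × SatisfiesCollapse) ⇔ (⊨ strictEquivFormula))
theorem30 𝓜 (S3 , normal) =
    ⇔.trans booleanCollapse⇔antisymmetric (⇔.sym booleanNEC≡f⊤⇔antisymmetric)
  , ⇔.trans booleanCollapse⇔antisymmetric antisymmetric⇔partialOrder
  , ⇔.trans booleanCollapse⇔antisymmetric
      (⇔.trans antisymmetric⇔identityIsStrictEquivalence (⇔.sym ⊨strictEquivFormula⇔))
  where open NormalS3Model 𝓜 S3 normal
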